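{- Let $v\ge 2$ and $1\le t\le s$ be integers. If there is a $(t,s,v)$-AONT, then there is an $(s,s-t,t,v)$-resilient function.
   Context: A $(t,s,v)$-all-or-nothing transform (AONT) over an alphabet $X$ with $|X|=v$ is a bijection $\phi: X^s\to X^s$ such that for every $I\subseteq\{1,\dots,s\}$ with $|I|=t$ and every $J\subseteq\{1,\dots,s\}$ with $|J|=t$, for every $\mathbf{a}\in X^{I}$ and every $\mathbf{b}\in X^{\{1,\dots,s\}\setminus J}$ there is exactly one $\mathbf{x}\in X^s$ with $\mathbf{x}|_I=\mathbf{a}$ and $\phi(\mathbf{x})|_{\{1,\dots,s\}\setminus J}=\mathbf{b}$ (i.e., given any $s-t$ outputs, any $t$ inputs are completely undetermined). An $(n,m,t,v)$-resilient function is a function $g: X^n\to X^m$, $|X|=v$, such that if any $t$ of the $n$ input values are fixed and the remaining $n-t$ input values are chosen independently and uniformly at random, then every output $m$-tuple occurs with probability exactly $1/v^m$. -}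

module Defs where

open import Data.Nat using (ℕ; zero; suc; _*_; _^_; _∸_)
open import Data.Fin using (Fin)
import Data.Fin as Fin
open import Data.Fin.Properties using (all?)
open import Data.Fin.Subset using (Subset; _∈_; ∁; ∣_∣)
open import Data.Fin.Subset.Properties using (_∈?_)
open import Data.Vec using (Vec; []; _∷_; lookup)
open import Data.Vec.Properties using (≡-dec)
open import Data.List using (List; [_]; map; concatMap; length; filter)
open import Data.Fin.Base using ()
open import Data.List using ()
open import Data.Product using (_×_; ∃!)
open import Function.Definitions using (Bijective)
open import Relation.Nullary using (Dec; yes; no)
open import Relation.Nullary.Decidable using (_×-dec_; _→-dec_)
open import Relation.Unary using (Decidable)
open import Relation.Binary.PropositionalEquality using (_≡_)
import Data.List as L

Word : ℕ → ℕ → Set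
Word v n = Vec (Fin v) n

allWords : (v n : ℕ) → List (Word v n)
allWords v zero = [ [] ]
allWords v (suc n) = concatMap (λ x → map (x ∷_) (allWords v n)) (L.allFin v)

countWords : ∀ {v n} (P : Word v n → Set) → Decidable P → ℕ
countWords {v} {n} P P? = length (filter P? (allWords v n))

AgreeOn : ∀ {v n} → Subset n → Word v n → Word v n → Set
AgreeOn I x a = ∀ i → i ∈ I → lookup x i ≡ lookup a i

agreeOn? : ∀ {v n} (I : Subset n) (x a : Word v n) → Dec (AgreeOn I x a)
agreeOn? I x a = all? (λ i → (i ∈? I) →-dec (lookup x i Fin.≟ lookup a i))

IsAONT : (t s v : ℕ) → (Word v s → Word v s) → Set
IsAONT t s v φ =
  Bijective _≡_ _≡_ φ ×
  (∀ (I J : Subset s) → ∣ I ∣ ≡ t → ∣ J ∣ ≡ t →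
     ∀ (a b : Word v s) →
       ∃! _≡_ (λ x → AgreeOn I x a × AgreeOn (∁ J) (φ x) b))

-- (n,m,t,v)-resilient function: for every t-set I of inputs, every
-- assignment a of them, and every output y, the number of x with
-- x|_I = a and g x = y, divided by the v^(n-t) such x, equals 1/v^m.
IsResilient : (n m t v : ℕ) → (Word v n → Word v m) → Set
IsResilient n m t v g =
  ∀ (I : Subset n) → ∣ I ∣ ≡ t →
  ∀ (a : Word v n) (y : Word v m) →
    countWords (λ x → AgreeOn I x a × g x ≡ y)
               (λ x → agreeOn? I x a ×-dec ≡-dec Fin._≟_ (g x) y)
      * v ^ m ≡ v ^ (n ∸ t)

-- Project the AONT's output onto the s − t coordinates outside a fixed t-set J: g x := φ(x)|_{∁J}.
-- For inputs fixed on a t-set I to a and a target y, extend y to some word b; then g x = y says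
-- exactly that φ(x) agrees with b outside J, and the AONT property makes such an x with x|_I = a
-- unique. So every fibre has size 1 = v^(s−t) / v^(s−t), as resilience demands.
module Submission where

open import Defs
open import Data.Nat using (ℕ; _≤_; _∸_; suc; _*_; _^_; z≤n; s≤s)
open import Data.Nat.Properties using (*-identityˡ)
open import Data.Fin using (Fin)
import Data.Fin as Fin
open import Data.Fin.Subset using (Subset; ∁; ∣_∣; ⊥; inside; outside)
open import Data.Fin.Subset.Properties using (∣⊥∣≡0; ∣∁p∣≡n∸∣p∣)
open import Data.Vec using (Vec; []; _∷_; here; there)
open import Data.Vec.Properties using (∷-injective; ≡-dec)
open import Data.List using ([]; _∷_; _++_; map; concatMap; length; filter; cartesianProductWith; allFin)
open import Data.List.Properties using (filter-accept; filter-reject; filter-none)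
open import Data.List.Membership.Propositional using (_∈_)
open import Data.List.Membership.Propositional.Properties using (∈-allFin; ∈-cartesianProductWith⁺)
open import Data.List.Relation.Unary.Any using (Any)
open import Data.List.Relation.Unary.All as All using (All)
open import Data.List.Relation.Unary.AllPairs using ([]; _∷_)
open import Data.List.Relation.Unary.Unique.Propositional using (Unique)
open import Data.List.Relation.Unary.Unique.Propositional.Properties using (allFin⁺; cartesianProductWith⁺)
open import Data.Product using (∃; ∃!; _×_; _,_; proj₁; proj₂)
open import Function using (_∘_)
open import Relation.Unary using (Decidable)
open import Relation.Nullary.Decidable using (_×-dec_)
open import Relation.Binary.PropositionalEquality

module _ {A : Set} {P : A → Set} (P? : Decidable P) where

  length-filter-unique : ∀ {x xs} → Unique xs → x ∈ xs → P x → (∀ {y} → P y → x ≡ y) →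
                         length (filter P? xs) ≡ 1
  length-filter-unique {x} {_ ∷ xs} (x∉xs ∷ _) (Any.here refl) px unique = begin
    length (filter P? (x ∷ xs))   ≡⟨ cong length (filter-accept P? px) ⟩
    suc (length (filter P? xs))   ≡⟨ cong (suc ∘ length) (filter-none P? (All.map (λ x≢y py → x≢y (unique py)) x∉xs)) ⟩
    1                             ∎
    where open ≡-Reasoning
  length-filter-unique {x} {y ∷ xs} (y∉xs ∷ uxs) (Any.there x∈xs) px unique = begin
    length (filter P? (y ∷ xs))   ≡⟨ cong length (filter-reject P? (λ py → All.lookup y∉xs x∈xs (sym (unique py)))) ⟩
    length (filter P? xs)         ≡⟨ length-filter-unique uxs x∈xs px unique ⟩
    1                             ∎
    where open ≡-Reasoning

concatMap-map≡cartesianProductWith : ∀ {A B C : Set} (f : A → B → C) xs ys →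
                                     concatMap (λ x → map (f x) ys) xs ≡ cartesianProductWith f xs ys
concatMap-map≡cartesianProductWith f []       ys = refl
concatMap-map≡cartesianProductWith f (x ∷ xs) ys = cong (map (f x) ys ++_) (concatMap-map≡cartesianProductWith f xs ys)

allWords-suc : ∀ v n → allWords v (suc n) ≡ cartesianProductWith _∷_ (allFin v) (allWords v n)
allWords-suc v n = concatMap-map≡cartesianProductWith _∷_ (allFin v) (allWords v n)

allWords-unique : ∀ v n → Unique (allWords v n)
allWords-unique v 0       = All.[] ∷ []
allWords-unique v (suc n) rewrite allWords-suc v n =
  cartesianProductWith⁺ _∷_ ∷-injective (allFin⁺ v) (allWords-unique v n)

∈-allWords : ∀ {v n} (w : Word v n) → w ∈ allWords v n
∈-allWords []      = Any.here refl
∈-allWords {v} {suc n} (c ∷ w) rewrite allWords-suc v n =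
  ∈-cartesianProductWith⁺ _∷_ (∈-allFin c) (∈-allWords w)

countWords-unique : ∀ {v n} (P : Word v n → Set) (P? : Decidable P) → ∃! _≡_ P → countWords P P? ≡ 1
countWords-unique {v} {n} P P? (x , px , unique) =
  length-filter-unique P? (allWords-unique v n) (∈-allWords x) px unique

restrict : ∀ {A : Set} {n} (K : Subset n) → Vec A n → Vec A ∣ K ∣
restrict []            []       = []
restrict (inside ∷ K)  (x ∷ xs) = x ∷ restrict K xs
restrict (outside ∷ K) (_ ∷ xs) = restrict K xs

module _ {v : ℕ} where

  AgreeOn⇒restrict-≡ : ∀ {n} (K : Subset n) {u w : Word v n} → AgreeOn K u w → restrict K u ≡ restrict K w
  AgreeOn⇒restrict-≡ []            {[]}    {[]}    _     = refl
  AgreeOn⇒restrict-≡ (inside ∷ K)  {_ ∷ _} {_ ∷ _} agree =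
    cong₂ _∷_ (agree Fin.zero here) (AgreeOn⇒restrict-≡ K (λ i i∈K → agree (Fin.suc i) (there i∈K)))
  AgreeOn⇒restrict-≡ (outside ∷ K) {_ ∷ _} {_ ∷ _} agree =
    AgreeOn⇒restrict-≡ K (λ i i∈K → agree (Fin.suc i) (there i∈K))

  restrict-≡⇒AgreeOn : ∀ {n} (K : Subset n) {u w : Word v n} → restrict K u ≡ restrict K w → AgreeOn K u w
  restrict-≡⇒AgreeOn (inside ∷ K)  {_ ∷ _} {_ ∷ _} eq Fin.zero    here        = proj₁ (∷-injective eq)
  restrict-≡⇒AgreeOn (inside ∷ K)  {_ ∷ _} {_ ∷ _} eq (Fin.suc i) (there i∈K) =
    restrict-≡⇒AgreeOn K (proj₂ (∷-injective eq)) i i∈K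
  restrict-≡⇒AgreeOn (outside ∷ K) {_ ∷ _} {_ ∷ _} eq (Fin.suc i) (there i∈K) = restrict-≡⇒AgreeOn K eq i i∈K

restrict-surjective : ∀ {A : Set} {n} → A → (K : Subset n) (y : Vec A ∣ K ∣) → ∃ λ b → restrict K b ≡ y
restrict-surjective d []            []       = [] , refl
restrict-surjective d (inside ∷ K)  (y ∷ ys) with b , eq ← restrict-surjective d K ys = y ∷ b , cong (y ∷_) eq
restrict-surjective d (outside ∷ K) ys       with b , eq ← restrict-surjective d K ys = d ∷ b , eq

project : ∀ {v n m} (K : Subset n) → ∣ K ∣ ≡ m → Word v n → Word v m
project {v} K eq = subst (Word v) eq ∘ restrict K

module _ {v n m : ℕ} where

  AgreeOn⇒project-≡ : (K : Subset n) (eq : ∣ K ∣ ≡ m) {u w : Word v n} → AgreeOn K u w → project K eq u ≡ project K eq w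
  AgreeOn⇒project-≡ K refl = AgreeOn⇒restrict-≡ K

  project-≡⇒AgreeOn : (K : Subset n) (eq : ∣ K ∣ ≡ m) {u w : Word v n} → project K eq u ≡ project K eq w → AgreeOn K u w
  project-≡⇒AgreeOn K refl = restrict-≡⇒AgreeOn K

  project-surjective : Fin v → (K : Subset n) (eq : ∣ K ∣ ≡ m) (y : Word v m) → ∃ λ b → project K eq b ≡ y
  project-surjective d K refl = restrict-surjective d K

subset-of-size : ∀ {t s} → t ≤ s → ∃ λ (J : Subset s) → ∣ J ∣ ≡ t
subset-of-size {s = s} z≤n = ⊥ , ∣⊥∣≡0 s
subset-of-size (s≤s t≤s) with J , ∣J∣≡t ← subset-of-size t≤s = inside ∷ J , cong suc ∣J∣≡t

AONT⇒resilient : ∀ {t s v} {φ : Word v s → Word v s} → IsAONT t s v φ → Fin v →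
                 (J : Subset s) → ∣ J ∣ ≡ t → (eq : ∣ ∁ J ∣ ≡ s ∸ t) →
                 IsResilient s (s ∸ t) t v (project (∁ J) eq ∘ φ)
AONT⇒resilient {t} {s} {v} {φ} (_ , aont) d J ∣J∣≡t eq I ∣I∣≡t a y = begin
  countWords Fiber Fiber? * v ^ (s ∸ t) ≡⟨ cong (_* v ^ (s ∸ t)) (countWords-unique Fiber Fiber? fiber-unique) ⟩
  1 * v ^ (s ∸ t)                       ≡⟨ *-identityˡ _ ⟩
  v ^ (s ∸ t)                           ∎
  where
  open ≡-Reasoning
  Fiber : Word v s → Set
  Fiber x = AgreeOn I x a × project (∁ J) eq (φ x) ≡ y
  Fiber? : Decidable Fiber
  Fiber? x = agreeOn? I x a ×-dec ≡-dec Fin._≟_ (project (∁ J) eq (φ x)) y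
  fiber-unique : ∃! _≡_ Fiber
  fiber-unique with b , πb≡y ← project-surjective d (∁ J) eq y
               with x , (x|I≡a , φx|∁J≡b) , unique ← aont I J ∣I∣≡t ∣J∣≡t a b =
    x , (x|I≡a , trans (AgreeOn⇒project-≡ (∁ J) eq φx|∁J≡b) πb≡y)
      , λ (z|I≡a , πφz≡y) → unique (z|I≡a , project-≡⇒AgreeOn (∁ J) eq (trans πφz≡y (sym πb≡y)))

theorem27 : (v s t : ℕ) → 2 ≤ v → 1 ≤ t → t ≤ s →
    ∃ (λ φ → IsAONT t s v φ) →
    ∃ (λ g → IsResilient s (s ∸ t) t v g)
theorem27 v s t (s≤s _) _ t≤s (φ , isAONT) =
  let J , ∣J∣≡t = subset-of-size t≤s
      ∣∁J∣≡s∸t  = trans (∣∁p∣≡n∸∣p∣ J) (cong (s ∸_) ∣J∣≡t)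
  in project (∁ J) ∣∁J∣≡s∸t ∘ φ , AONT⇒resilient isAONT Fin.zero J ∣J∣≡t ∣∁J∣≡s∸t
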